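{- A position $(n_0,\dots,n_7)$ of ${\rm ECN}(8_{\{1,3\}},2)$ is a $\mathcal{P}$-position if and only if $n_0\oplus n_2\oplus n_4\oplus n_6 = n_1\oplus n_3\oplus n_5\oplus n_7 = 0$.
   Context: Extended circular nim ${\rm ECN}(m_S,k)$ (positive integers $k\le m$, $S$ a set of positive integers each at most $m/2$): there are $m$ piles $v_0,\dots,v_{m-1}$ arranged in a circle (indices mod $m$); a position is a tuple $(n_0,\dots,n_{m-1})$ of nonnegative integers, $n_i$ being the number of tokens on $v_i$. A move chooses $s\in S$, $i\in\{0,\dots,m-1\}$, $j\in\{0,\dots,k-1\}$ and removes an arbitrary nonnegative number of tokens from each pile $v_{(i+ts)\bmod m}$, $t=0,\dots,j$, removing at least one token in total (empty piles still count as piles). Normal play: the player unable to move loses. A $\mathcal{P}$-position is a position from which the previous player (the player who just moved) has a winning strategy. $\oplus$ denotes bitwise exclusive OR (nim-sum). -}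

module Defs where

open import Data.Nat using (ℕ; zero; suc; _+_; _*_; _≤_; _<_; NonZero)
open import Data.Nat.DivMod using (_/_; _%_)
open import Data.Fin using (Fin; toℕ)
open import Data.List using (List; []; _∷_)
open import Data.List.Membership.Propositional using (_∈_)
open import Data.Product using (Σ; ∃; _×_; _,_)
open import Relation.Binary.PropositionalEquality using (_≡_)
open import Relation.Nullary using (¬_)

-- Bitwise exclusive OR (nim-sum) on ℕ.
-- xorAux f a b processes f bits (least significant first);
-- f = a + b bits always suffice, since a, b < 2 ^ (a + b).

xorAux : ℕ → ℕ → ℕ → ℕ
xorAux zero    a b = 0
xorAux (suc f) a b = ((a % 2) + (b % 2)) % 2 + 2 * xorAux f (a / 2) (b / 2)

infixl 6 _⊕_
_⊕_ : ℕ → ℕ → ℕ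
a ⊕ b = xorAux (a + b) a b

Position : ℕ → Set
Position m = Fin m → ℕ

InBlock : (m : ℕ) .{{_ : NonZero m}} → (s : ℕ) → Fin m → (j : ℕ) → Fin m → Set
InBlock m s i j l = Σ ℕ λ t → t ≤ j × toℕ l ≡ (toℕ i + t * s) % m

Move : (m : ℕ) .{{_ : NonZero m}} → (S : List ℕ) → (k : ℕ) →
       Position m → Position m → Set
Move m S k p q =
  Σ ℕ λ s → s ∈ S × Σ (Fin m) λ i → Σ ℕ λ j → j < k ×
    ((∀ l → q l ≤ p l) ×
     (∀ l → ¬ InBlock m s i j l → q l ≡ p l) ×
     (Σ (Fin m) λ l → q l < p l))

-- The game is finite (total
-- number of tokens strictly decreases), so this is the usual notion.
mutual
  data IsP (m : ℕ) .{{_ : NonZero m}} (S : List ℕ) (k : ℕ) (p : Position m) : Set where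
    isP : (∀ q → Move m S k p q → IsN m S k q) → IsP m S k p

  data IsN (m : ℕ) .{{_ : NonZero m}} (S : List ℕ) (k : ℕ) (p : Position m) : Set where
    isN : ∀ q → Move m S k p q → IsP m S k q → IsN m S k p

{-# OPTIONS --safe #-}
-- The piles split into two parity classes, even and odd indices. Every s ∈ {1, 3} is odd and a
-- block is v_i or {v_i, v_(i+s)}, so a move changes at most one pile of each class; conversely,
-- any even pile and any odd pile lie in a common block. The game thus behaves like two Nim games,
-- on the even and on the odd piles, where a move plays in one of them or in both at once, and
-- Bouton's argument goes through: from a position where both classes have nim-sum 0, every move
-- leaves the class of a pile it decreases with nonzero nim-sum, while from any other position the
-- Bouton replies in the two classes together form one legal move back to nim-sums 0.
module Submission where

open import Defs
open import Algebra.Bundles using (AbelianGroup)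
open import Algebra.Structures using (IsAbelianGroup)
open import Data.Fin using (Fin; zero; suc; toℕ; #_; punchIn; combine; quotient; remainder)
open import Data.Fin.Patterns using (0F; 1F; 2F; 3F)
open import Data.Fin.Properties
  using (punchInᵢ≢i; toℕ-injective; toℕ<n; toℕ-combine; combine-injectiveˡ; combine-remQuot;
         remQuot-combine; all?; ¬∀⟶∃¬)
  renaming (_≟_ to _≟ᶠ_)
open import Data.List using (List; []; _∷_)
open import Data.List.Membership.Propositional using (_∈_)
open import Data.List.Relation.Unary.Any using (here; there)
open import Data.Nat
open import Data.Nat.DivMod
open import Data.Nat.Divisibility using (_∣_; divides)
open import Data.Nat.Induction using (<-wellFounded)
open import Data.Nat.Properties
open import Data.Nat.Tactic.RingSolver using (solve-∀)
open import Data.Product using (_,_; proj₁; proj₂; _×_; ∃-syntax; Σ-syntax)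
open import Data.Sum using (_⊎_; inj₁; inj₂)
open import Data.Vec.Functional using (Vector; map; tail; removeAt; updateAt)
open import Data.Vec.Functional.Properties using (updateAt-updates; updateAt-minimal)
open import Function using (id; flip; _∘_; _⇔_; mk⇔)
open import Function.Construct.Composition using (_⇔-∘_)
open import Induction.WellFounded using (WellFounded; Acc; acc; module Subrelation)
open import Level using (0ℓ)
open import Relation.Binary.Construct.On as On using ()
open import Relation.Binary.PropositionalEquality
open import Relation.Nullary using (¬_; yes; no)
open import Relation.Nullary.Decidable using (decidable-stable)
open import Relation.Nullary.Negation using (contradiction)
open import Relation.Unary using (Decidable)

m≡m%2+2*[m/2] : ∀ m → m ≡ m % 2 + 2 * (m / 2)
m≡m%2+2*[m/2] m = trans (m≡m%n+[m/n]*n m 2) (cong (m % 2 +_) (*-comm (m / 2) 2))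

[r+2*q]%2≡r : ∀ r q → r < 2 → (r + 2 * q) % 2 ≡ r
[r+2*q]%2≡r r q r<2 = begin
  (r + 2 * q) % 2  ≡⟨ cong (λ x → (r + x) % 2) (*-comm 2 q) ⟩
  (r + q * 2) % 2  ≡⟨ [m+kn]%n≡m%n r q 2 ⟩
  r % 2            ≡⟨ m<n⇒m%n≡m r<2 ⟩
  r                ∎
  where open ≡-Reasoning

[r+2*q]/2≡q : ∀ r q → r < 2 → (r + 2 * q) / 2 ≡ q
[r+2*q]/2≡q r q r<2 = begin
  (r + 2 * q) / 2    ≡⟨ cong (λ x → (r + x) / 2) (*-comm 2 q) ⟩
  (r + q * 2) / 2    ≡⟨ +-distrib-/ r (q * 2) no-carry ⟩
  r / 2 + q * 2 / 2  ≡⟨ cong₂ _+_ (m<n⇒m/n≡0 r<2) (m*n/n≡m q 2) ⟩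
  q                  ∎
  where
  open ≡-Reasoning
  no-carry : r % 2 + q * 2 % 2 < 2
  no-carry = subst (_< 2) (sym (trans (cong₂ _+_ (m<n⇒m%n≡m r<2) (m*n%n≡0 q 2)) (+-identityʳ r))) r<2

[m+m]%2≡0 : ∀ m → (m + m) % 2 ≡ 0
[m+m]%2≡0 m = begin
  (m + m) % 2        ≡⟨ cong (λ x → (m + x) % 2) (+-identityʳ m) ⟨
  (2 * m) % 2        ≡⟨ cong (_% 2) (*-comm 2 m) ⟩
  (m * 2) % 2        ≡⟨ m*n%n≡0 m 2 ⟩
  0                  ∎
  where open ≡-Reasoning

%2-cases : ∀ m → m % 2 ≡ 0 ⊎ m % 2 ≡ 1
%2-cases m with m % 2 | m%n<n m 2
... | 0 | _ = inj₁ refl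
... | 1 | _ = inj₂ refl
... | suc (suc _) | s≤s (s≤s ())

m/2≡0⇒m≡1 : ∀ {m} → m / 2 ≡ 0 → m ≢ 0 → m ≡ 1
m/2≡0⇒m≡1 m/2≡0 = m<2⇒m≡1 (m/n≡0⇒m<n m/2≡0)
  where
  m<2⇒m≡1 : ∀ {m} → m < 2 → m ≢ 0 → m ≡ 1
  m<2⇒m≡1 {0} _ m≢0 = contradiction refl m≢0
  m<2⇒m≡1 {1} _ _ = refl
  m<2⇒m≡1 {suc (suc _)} (s≤s (s≤s ()))

[r+1]%2≢r : ∀ r → r < 2 → (r + 1) % 2 ≢ r
[r+1]%2≢r 0 _ ()
[r+1]%2≢r 1 _ ()
[r+1]%2≢r (suc (suc _)) (s≤s (s≤s ()))

[m+odd]%2≢m%2 : ∀ {s} → s % 2 ≡ 1 → ∀ m → (m + s) % 2 ≢ m % 2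
[m+odd]%2≢m%2 {s} s-odd m eq = [r+1]%2≢r (m % 2) (m%n<n m 2) (begin
  (m % 2 + 1) % 2      ≡⟨ cong (λ r → (m % 2 + r) % 2) s-odd ⟨
  (m % 2 + s % 2) % 2  ≡⟨ %-distribˡ-+ m s 2 ⟨
  (m + s) % 2          ≡⟨ eq ⟩
  m % 2                ∎)
  where open ≡-Reasoning

m≤1+n⇒m/2≤n : ∀ {m n} → m ≤ suc n → m / 2 ≤ n
m≤1+n⇒m/2≤n {n = n} m≤1+n = <⇒≤pred (≤-<-trans (/-monoˡ-≤ 2 m≤1+n) (m/n<m (suc n) 2 (s≤s (s≤s z≤n))))

m/2+n/2≤[m+n]/2 : ∀ m n → m / 2 + n / 2 ≤ (m + n) / 2
m/2+n/2≤[m+n]/2 m n = begin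
  m / 2 + n / 2                ≡⟨ m*n/n≡m (m / 2 + n / 2) 2 ⟨
  (m / 2 + n / 2) * 2 / 2      ≡⟨ cong (_/ 2) (*-distribʳ-+ 2 (m / 2) (n / 2)) ⟩
  (m / 2 * 2 + n / 2 * 2) / 2  ≤⟨ /-monoˡ-≤ 2 (+-mono-≤ (m/n*n≤m m 2) (m/n*n≤m n 2)) ⟩
  (m + n) / 2                  ∎
  where open ≤-Reasoning

m+n≤1+o⇒m/2+n/2≤o : ∀ {m n o} → m + n ≤ suc o → m / 2 + n / 2 ≤ o
m+n≤1+o⇒m/2+n/2≤o {m} {n} m+n≤1+o = ≤-trans (m/2+n/2≤[m+n]/2 m n) (m≤1+n⇒m/2≤n m+n≤1+o)

xorAux-suc-%2 : ∀ f a b → xorAux (suc f) a b % 2 ≡ (a + b) % 2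
xorAux-suc-%2 f a b =
  trans ([r+2*q]%2≡r _ (xorAux f (a / 2) (b / 2)) (m%n<n (a % 2 + b % 2) 2)) (sym (%-distribˡ-+ a b 2))

xorAux-suc-/2 : ∀ f a b → xorAux (suc f) a b / 2 ≡ xorAux f (a / 2) (b / 2)
xorAux-suc-/2 f a b = [r+2*q]/2≡q _ (xorAux f (a / 2) (b / 2)) (m%n<n (a % 2 + b % 2) 2)

xorAux-comm : ∀ f a b → xorAux f a b ≡ xorAux f b a
xorAux-comm zero    a b = refl
xorAux-comm (suc f) a b =
  cong₂ (λ r q → r % 2 + 2 * q) (+-comm (a % 2) (b % 2)) (xorAux-comm f (a / 2) (b / 2))

xorAux-assoc : ∀ f a b c → xorAux f (xorAux f a b) c ≡ xorAux f a (xorAux f b c)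
xorAux-assoc zero    a b c = refl
xorAux-assoc (suc f) a b c = cong₂ (λ r q → r + 2 * q) low-digit high-digits
  where
  open ≡-Reasoning
  low-digit : (xorAux (suc f) a b % 2 + c % 2) % 2 ≡ (a % 2 + xorAux (suc f) b c % 2) % 2
  low-digit = begin
    (xorAux (suc f) a b % 2 + c % 2) % 2  ≡⟨ cong (λ r → (r + c % 2) % 2) (xorAux-suc-%2 f a b) ⟩
    ((a + b) % 2 + c % 2) % 2             ≡⟨ %-distribˡ-+ (a + b) c 2 ⟨
    (a + b + c) % 2                       ≡⟨ cong (_% 2) (+-assoc a b c) ⟩
    (a + (b + c)) % 2                     ≡⟨ %-distribˡ-+ a (b + c) 2 ⟩
    (a % 2 + (b + c) % 2) % 2             ≡⟨ cong (λ r → (a % 2 + r) % 2) (xorAux-suc-%2 f b c) ⟨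
    (a % 2 + xorAux (suc f) b c % 2) % 2  ∎
  high-digits : xorAux f (xorAux (suc f) a b / 2) (c / 2) ≡ xorAux f (a / 2) (xorAux (suc f) b c / 2)
  high-digits = begin
    xorAux f (xorAux (suc f) a b / 2) (c / 2)      ≡⟨ cong (λ x → xorAux f x (c / 2)) (xorAux-suc-/2 f a b) ⟩
    xorAux f (xorAux f (a / 2) (b / 2)) (c / 2)    ≡⟨ xorAux-assoc f (a / 2) (b / 2) (c / 2) ⟩
    xorAux f (a / 2) (xorAux f (b / 2) (c / 2))    ≡⟨ cong (xorAux f (a / 2)) (xorAux-suc-/2 f b c) ⟨
    xorAux f (a / 2) (xorAux (suc f) b c / 2)      ∎

xorAux-self : ∀ f a → xorAux f a a ≡ 0
xorAux-self zero    a = refl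
xorAux-self (suc f) a = cong₂ (λ r q → r + 2 * q)
  (trans (sym (%-distribˡ-+ a a 2)) ([m+m]%2≡0 a)) (xorAux-self f (a / 2))

xorAux-identityʳ : ∀ f {a} → a ≤ f → xorAux f a 0 ≡ a
xorAux-identityʳ zero    z≤n = refl
xorAux-identityʳ (suc f) {a} a≤1+f = begin
  (a % 2 + 0) % 2 + 2 * xorAux f (a / 2) 0  ≡⟨ cong₂ (λ r q → r % 2 + 2 * q) (+-identityʳ (a % 2))
                                                      (xorAux-identityʳ f (m≤1+n⇒m/2≤n a≤1+f)) ⟩
  a % 2 % 2 + 2 * (a / 2)                   ≡⟨ cong (_+ 2 * (a / 2)) (m%n%n≡m%n a 2) ⟩
  a % 2 + 2 * (a / 2)                       ≡⟨ m≡m%2+2*[m/2] a ⟨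
  a                                         ∎
  where open ≡-Reasoning

xorAux-≤ : ∀ f a b → xorAux f a b ≤ a + b
xorAux-≤ zero    a b = z≤n
xorAux-≤ (suc f) a b = begin
  (a % 2 + b % 2) % 2 + 2 * xorAux f (a / 2) (b / 2)
    ≤⟨ +-mono-≤ (m%n≤m (a % 2 + b % 2) 2) (*-monoʳ-≤ 2 (xorAux-≤ f (a / 2) (b / 2))) ⟩
  (a % 2 + b % 2) + 2 * (a / 2 + b / 2)
    ≡⟨ regroup (a % 2) (b % 2) (a / 2) (b / 2) ⟩
  (a % 2 + 2 * (a / 2)) + (b % 2 + 2 * (b / 2))
    ≡⟨ cong₂ _+_ (m≡m%2+2*[m/2] a) (m≡m%2+2*[m/2] b) ⟨
  a + b ∎
  where
  open ≤-Reasoning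
  regroup : ∀ w x y z → (w + x) + 2 * (y + z) ≡ (w + 2 * y) + (x + 2 * z)
  regroup = solve-∀

-- Fuel beyond a + b only appends zero digits, so the laws of _⊕_ can be proved for xorAux at a
-- common fuel and transferred.
xorAux-fuel : ∀ f g {a b} → a + b ≤ f → a + b ≤ g → xorAux f a b ≡ xorAux g a b
xorAux-fuel zero    zero    _ _ = refl
xorAux-fuel zero    (suc g) {zero} {zero} _ _ = sym (xorAux-self (suc g) 0)
xorAux-fuel (suc f) zero    {zero} {zero} _ _ = xorAux-self (suc f) 0
xorAux-fuel (suc f) (suc g) {a} {b} hf hg =
  cong (λ q → (a % 2 + b % 2) % 2 + 2 * q)
       (xorAux-fuel f g (m+n≤1+o⇒m/2+n/2≤o {a} {b} hf) (m+n≤1+o⇒m/2+n/2≤o {a} {b} hg))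

xorAux≡⊕ : ∀ {f a b} → a + b ≤ f → xorAux f a b ≡ a ⊕ b
xorAux≡⊕ {f} {a} {b} a+b≤f = xorAux-fuel f (a + b) a+b≤f ≤-refl

⊕-≤ : ∀ a b → a ⊕ b ≤ a + b
⊕-≤ a b = xorAux-≤ (a + b) a b

⊕-comm : ∀ a b → a ⊕ b ≡ b ⊕ a
⊕-comm a b = trans (xorAux-comm (a + b) a b) (xorAux≡⊕ (≤-reflexive (+-comm b a)))

⊕-assoc : ∀ a b c → (a ⊕ b) ⊕ c ≡ a ⊕ (b ⊕ c)
⊕-assoc a b c = begin
  (a ⊕ b) ⊕ c                  ≡⟨ xorAux≡⊕ (+-monoˡ-≤ c (⊕-≤ a b)) ⟨
  xorAux F (a ⊕ b) c           ≡⟨ cong (λ x → xorAux F x c) (xorAux≡⊕ (m≤m+n (a + b) c)) ⟨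
  xorAux F (xorAux F a b) c    ≡⟨ xorAux-assoc F a b c ⟩
  xorAux F a (xorAux F b c)    ≡⟨ cong (xorAux F a) (xorAux≡⊕ b+c≤F) ⟩
  xorAux F a (b ⊕ c)           ≡⟨ xorAux≡⊕ a+[b⊕c]≤F ⟩
  a ⊕ (b ⊕ c)                  ∎
  where
  open ≡-Reasoning
  F = a + b + c
  b+c≤F : b + c ≤ F
  b+c≤F = ≤-trans (m≤n+m (b + c) a) (≤-reflexive (sym (+-assoc a b c)))
  a+[b⊕c]≤F : a + (b ⊕ c) ≤ F
  a+[b⊕c]≤F = ≤-trans (+-monoʳ-≤ a (⊕-≤ b c)) (≤-reflexive (sym (+-assoc a b c)))

⊕-self : ∀ a → a ⊕ a ≡ 0
⊕-self a = xorAux-self (a + a) a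

⊕-identityʳ : ∀ a → a ⊕ 0 ≡ a
⊕-identityʳ a = xorAux-identityʳ (a + 0) (m≤m+n a 0)

⊕-identityˡ : ∀ a → 0 ⊕ a ≡ a
⊕-identityˡ a = trans (⊕-comm 0 a) (⊕-identityʳ a)

⊕-isAbelianGroup : IsAbelianGroup _≡_ _⊕_ 0 id
⊕-isAbelianGroup = record
  { isGroup = record
    { isMonoid = record
      { isSemigroup = record
        { isMagma = record { isEquivalence = isEquivalence ; ∙-cong = cong₂ _⊕_ }
        ; assoc = ⊕-assoc
        }
      ; identity = ⊕-identityˡ , ⊕-identityʳ
      }
    ; inverse = ⊕-self , ⊕-self
    ; ⁻¹-cong = id
    }
  ; comm = ⊕-comm
  }

⊕-abelianGroup : AbelianGroup 0ℓ 0ℓ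
⊕-abelianGroup = record { isAbelianGroup = ⊕-isAbelianGroup }

⊕-unfold : ∀ a b → a ⊕ b ≡ xorAux (suc (a + b)) a b
⊕-unfold a b = sym (xorAux≡⊕ {a = a} {b} (n≤1+n (a + b)))

⊕-%2 : ∀ a b → (a ⊕ b) % 2 ≡ (a + b) % 2
⊕-%2 a b = trans (cong (_% 2) (⊕-unfold a b)) (xorAux-suc-%2 (a + b) a b)

⊕-/2 : ∀ a b → (a ⊕ b) / 2 ≡ a / 2 ⊕ b / 2
⊕-/2 a b = begin
  (a ⊕ b) / 2                          ≡⟨ cong (_/ 2) (⊕-unfold a b) ⟩
  xorAux (suc (a + b)) a b / 2         ≡⟨ xorAux-suc-/2 (a + b) a b ⟩
  xorAux (a + b) (a / 2) (b / 2)       ≡⟨ xorAux≡⊕ (+-mono-≤ (m/n≤m a 2) (m/n≤m b 2)) ⟩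
  a / 2 ⊕ b / 2                        ∎
  where open ≡-Reasoning

⊕-digits : ∀ a b → a ⊕ b ≡ (a + b) % 2 + 2 * (a / 2 ⊕ b / 2)
⊕-digits a b = trans (m≡m%2+2*[m/2] (a ⊕ b)) (cong₂ (λ r q → r + 2 * q) (⊕-%2 a b) (⊕-/2 a b))

open import Algebra.Properties.AbelianGroup ⊕-abelianGroup
  using (xyx⁻¹≈y; x∙y⁻¹≈ε⇒x≈y; identityˡ-unique)
open import Algebra.Properties.CommutativeSemigroup (AbelianGroup.commutativeSemigroup ⊕-abelianGroup)
  using (interchange)
open import Algebra.Properties.CommutativeMonoid.Sum (AbelianGroup.commutativeMonoid ⊕-abelianGroup)
  using () renaming (sum to nimSum; sum-remove to nimSum-remove; sum-cong-≗ to nimSum-cong)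

nimSum-change : ∀ {n} (e e′ : Vector ℕ (suc n)) k → (∀ j → j ≢ k → e′ j ≡ e j) →
                nimSum e′ ⊕ nimSum e ≡ e′ k ⊕ e k
nimSum-change e e′ k agree = begin
  nimSum e′ ⊕ nimSum e        ≡⟨ cong₂ _⊕_ (nimSum-remove {i = k} e′) (nimSum-remove {i = k} e) ⟩
  (e′ k ⊕ R′) ⊕ (e k ⊕ R)     ≡⟨ cong (λ r → (e′ k ⊕ r) ⊕ (e k ⊕ R)) R′≡R ⟩
  (e′ k ⊕ R) ⊕ (e k ⊕ R)      ≡⟨ interchange (e′ k) R (e k) R ⟩
  (e′ k ⊕ e k) ⊕ (R ⊕ R)      ≡⟨ cong ((e′ k ⊕ e k) ⊕_) (⊕-self R) ⟩
  (e′ k ⊕ e k) ⊕ 0            ≡⟨ ⊕-identityʳ (e′ k ⊕ e k) ⟩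
  e′ k ⊕ e k                  ∎
  where
  open ≡-Reasoning
  R = nimSum (removeAt e k)
  R′ = nimSum (removeAt e′ k)
  R′≡R : R′ ≡ R
  R′≡R = nimSum-cong (λ j → agree (punchIn k j) (punchInᵢ≢i k j))

nimSum-updateAt-⊕nimSum : ∀ {n} (e : Vector ℕ (suc n)) k → nimSum (updateAt e k (_⊕ nimSum e)) ≡ 0
nimSum-updateAt-⊕nimSum e k = identityˡ-unique (nimSum e′) (nimSum e) (begin
  nimSum e′ ⊕ nimSum e      ≡⟨ nimSum-change e e′ k (λ j j≢k → updateAt-minimal j k e j≢k) ⟩
  e′ k ⊕ e k                ≡⟨ cong (_⊕ e k) (updateAt-updates k e) ⟩
  e k ⊕ nimSum e ⊕ e k      ≡⟨ xyx⁻¹≈y (e k) (nimSum e) ⟩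
  nimSum e                  ∎)
  where
  open ≡-Reasoning
  e′ = updateAt e k (_⊕ nimSum e)

nimSum-/2 : ∀ {n} (e : Vector ℕ n) → nimSum e / 2 ≡ nimSum (map (_/ 2) e)
nimSum-/2 {zero}  e = refl
nimSum-/2 {suc n} e = trans (⊕-/2 (e zero) (nimSum (tail e))) (cong (e zero / 2 ⊕_) (nimSum-/2 (tail e)))

nimSum₄ : (e : Vector ℕ 4) → nimSum e ≡ e 0F ⊕ e 1F ⊕ e 2F ⊕ e 3F
nimSum₄ e = begin
  e 0F ⊕ (e 1F ⊕ (e 2F ⊕ (e 3F ⊕ 0)))  ≡⟨ cong (λ x → e 0F ⊕ (e 1F ⊕ (e 2F ⊕ x))) (⊕-identityʳ (e 3F)) ⟩
  e 0F ⊕ (e 1F ⊕ (e 2F ⊕ e 3F))        ≡⟨ ⊕-assoc (e 0F) (e 1F) (e 2F ⊕ e 3F) ⟨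
  e 0F ⊕ e 1F ⊕ (e 2F ⊕ e 3F)          ≡⟨ ⊕-assoc (e 0F ⊕ e 1F) (e 2F) (e 3F) ⟨
  e 0F ⊕ e 1F ⊕ e 2F ⊕ e 3F            ∎
  where open ≡-Reasoning

nimSum-odd⇒odd-entry : ∀ {n} (e : Vector ℕ n) → nimSum e % 2 ≡ 1 → ∃[ k ] e k % 2 ≡ 1
nimSum-odd⇒odd-entry {suc n} e odd with %2-cases (e zero)
... | inj₂ e₀-odd = zero , e₀-odd
... | inj₁ e₀-even = let k , ek-odd = nimSum-odd⇒odd-entry (tail e) tail-odd in suc k , ek-odd
  where
  open ≡-Reasoning
  R = nimSum (tail e)
  tail-odd : R % 2 ≡ 1
  tail-odd = begin
    R % 2                       ≡⟨ m%n%n≡m%n R 2 ⟨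
    (0 + R % 2) % 2             ≡⟨ cong (λ r → (r + R % 2) % 2) e₀-even ⟨
    (e zero % 2 + R % 2) % 2    ≡⟨ %-distribˡ-+ (e zero) R 2 ⟨
    (e zero + R) % 2            ≡⟨ ⊕-%2 (e zero) R ⟨
    (e zero ⊕ R) % 2            ≡⟨ odd ⟩
    1                           ∎

a/2⊕x/2<a/2⇒a⊕x<a : ∀ a x → a / 2 ⊕ x / 2 < a / 2 → a ⊕ x < a
a/2⊕x/2<a/2⇒a⊕x<a a x lt = begin-strict
  a ⊕ x                                ≡⟨ ⊕-digits a x ⟩
  (a + x) % 2 + 2 * (a / 2 ⊕ x / 2)    <⟨ +-monoˡ-< (2 * (a / 2 ⊕ x / 2)) (m%n<n (a + x) 2) ⟩
  2 + 2 * (a / 2 ⊕ x / 2)              ≡⟨ *-suc 2 (a / 2 ⊕ x / 2) ⟨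
  2 * suc (a / 2 ⊕ x / 2)              ≤⟨ *-monoʳ-≤ 2 lt ⟩
  2 * (a / 2)                          ≤⟨ m≤n+m (2 * (a / 2)) (a % 2) ⟩
  a % 2 + 2 * (a / 2)                  ≡⟨ m≡m%2+2*[m/2] a ⟨
  a                                    ∎
  where open ≤-Reasoning

a%2≡1⇒a⊕1<a : ∀ {a} → a % 2 ≡ 1 → a ⊕ 1 < a
a%2≡1⇒a⊕1<a {a} odd = begin-strict
  a ⊕ 1                         ≡⟨ ⊕-digits a 1 ⟩
  (a + 1) % 2 + 2 * (a / 2 ⊕ 0) ≡⟨ cong₂ (λ r q → r + 2 * q) even-succ (⊕-identityʳ (a / 2)) ⟩
  2 * (a / 2)                   <⟨ n<1+n (2 * (a / 2)) ⟩
  1 + 2 * (a / 2)               ≡⟨ cong (_+ 2 * (a / 2)) odd ⟨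
  a % 2 + 2 * (a / 2)           ≡⟨ m≡m%2+2*[m/2] a ⟨
  a                             ∎
  where
  open ≤-Reasoning
  even-succ : (a + 1) % 2 ≡ 0
  even-succ = trans (%-distribˡ-+ a 1 2) (cong (λ r → (r + 1) % 2) odd)

bouton-nimSum≡1 : ∀ {n} (e : Vector ℕ n) → nimSum e ≡ 1 → ∃[ k ] e k ⊕ nimSum e < e k
bouton-nimSum≡1 e X≡1 =
  let k , ek-odd = nimSum-odd⇒odd-entry e (cong (_% 2) X≡1)
  in k , subst (λ x → e k ⊕ x < e k) (sym X≡1) (a%2≡1⇒a⊕1<a ek-odd)

bouton : ∀ {n} (e : Vector ℕ n) → nimSum e ≢ 0 → ∃[ k ] e k ⊕ nimSum e < e k
bouton e = descend (nimSum e) e ≤-refl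
  where
  -- If the halves still have nonzero nim-sum, a pile that works for them works here, whatever the
  -- low digits; otherwise the nim-sum is 1 and any odd pile works.
  descend : ∀ {n} F (e : Vector ℕ n) → nimSum e ≤ F → nimSum e ≢ 0 → ∃[ k ] e k ⊕ nimSum e < e k
  descend zero    e X≤0 X≢0 = contradiction (n≤0⇒n≡0 X≤0) X≢0
  descend (suc F) e X≤1+F X≢0 with nimSum (map (_/ 2) e) ≟ 0
  ... | no H≢0 =
    let k , lt = descend F (map (_/ 2) e) (subst (_≤ F) (nimSum-/2 e) (m≤1+n⇒m/2≤n X≤1+F)) H≢0
    in k , a/2⊕x/2<a/2⇒a⊕x<a (e k) (nimSum e) (subst (λ h → e k / 2 ⊕ h < e k / 2) (sym (nimSum-/2 e)) lt)
  ... | yes H≡0 = bouton-nimSum≡1 e (m/2≡0⇒m≡1 (trans (nimSum-/2 e) H≡0) X≢0)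

nim-reply : ∀ {n} (e : Vector ℕ (suc n)) →
            ∃[ k ] e k ⊕ nimSum e ≤ e k × (nimSum e ≢ 0 → e k ⊕ nimSum e < e k)
nim-reply e with nimSum e ≟ 0
... | yes X≡0 = zero , ≤-reflexive (trans (cong (e zero ⊕_) X≡0) (⊕-identityʳ (e zero))) , contradiction X≡0
... | no X≢0  = let k , lt = bouton e X≢0 in k , <⇒≤ lt , λ _ → lt

module NimReply {n} (e : Vector ℕ (suc n)) where

  index : Fin (suc n)
  index = proj₁ (nim-reply e)

  reply : Vector ℕ (suc n)
  reply = updateAt e index (_⊕ nimSum e)

  reply-balanced : nimSum reply ≡ 0
  reply-balanced = nimSum-updateAt-⊕nimSum e index

  reply-≤ : ∀ j → reply j ≤ e j
  reply-≤ j with j ≟ᶠ index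
  ... | yes refl = subst (_≤ e j) (sym (updateAt-updates j e)) (proj₁ (proj₂ (nim-reply e)))
  ... | no j≢k   = ≤-reflexive (updateAt-minimal j index e j≢k)

  reply-elsewhere : ∀ j → j ≢ index → reply j ≡ e j
  reply-elsewhere j j≢k = updateAt-minimal j index e j≢k

  reply-< : nimSum e ≢ 0 → reply index < e index
  reply-< X≢0 = subst (_< e index) (sym (updateAt-updates index e)) (proj₂ (proj₂ (nim-reply e)) X≢0)

open import Algebra.Properties.CommutativeMonoid.Sum +-0-commutativeMonoid using (sum; sum-remove)

sum-mono-≤ : ∀ {n} {u v : Vector ℕ n} → (∀ i → u i ≤ v i) → sum u ≤ sum v
sum-mono-≤ {zero}  _   = z≤n
sum-mono-≤ {suc n} u≤v = +-mono-≤ (u≤v zero) (sum-mono-≤ (u≤v ∘ suc))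

sum-mono-< : ∀ {n} {u v : Vector ℕ n} → (∀ i → u i ≤ v i) → ∀ l → u l < v l → sum u < sum v
sum-mono-< {suc n} {u} {v} u≤v l ul<vl = begin-strict
  sum u                        ≡⟨ sum-remove {i = l} u ⟩
  u l + sum (removeAt u l)     <⟨ +-mono-<-≤ ul<vl (sum-mono-≤ (u≤v ∘ punchIn l)) ⟩
  v l + sum (removeAt v l)     ≡⟨ sum-remove {i = l} v ⟨
  sum v                        ∎
  where open ≤-Reasoning

module _ {m} .{{_ : NonZero m}} {S : List ℕ} {k : ℕ} where

  Move⇒sum< : ∀ {p q} → Move m S k p q → sum q < sum p
  Move⇒sum< (_ , _ , _ , _ , _ , q≤p , _ , l , ql<pl) = sum-mono-< q≤p l ql<pl

  Move-wellFounded : WellFounded (flip (Move m S k))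
  Move-wellFounded = Subrelation.wellFounded Move⇒sum< (On.wellFounded sum <-wellFounded)

  IsP⇒¬IsN : ∀ {p} → IsP m S k p → ¬ IsN m S k p
  IsP⇒¬IsN (isP P⇒N) (isN q mv Pq) = IsP⇒¬IsN Pq (P⇒N q mv)

  IsP⇔kernel : {Z : Position m → Set} → Decidable Z →
               (∀ {p q} → Z p → Move m S k p q → ¬ Z q) →
               (∀ {p} → ¬ Z p → ∃[ q ] Move m S k p q × Z q) →
               ∀ p → IsP m S k p ⇔ Z p
  IsP⇔kernel {Z} Z? leave enter p = mk⇔
    (λ Pp → decidable-stable (Z? p) (IsP⇒¬IsN Pp ∘ proj₂ (classify (Move-wellFounded p))))
    (proj₁ (classify (Move-wellFounded p)))
    where
    classify : ∀ {p} → Acc (flip (Move m S k)) p → (Z p → IsP m S k p) × (¬ Z p → IsN m S k p)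
    classify (acc rs) =
      (λ Zp → isP λ q mv → proj₂ (classify (rs mv)) (leave Zp mv)) ,
      (λ ¬Zp → let q , mv , Zq = enter ¬Zp in isN q mv (proj₁ (classify (rs mv)) Zq))

module _ {m} .{{_ : NonZero m}} (2∣m : 2 ∣ m) {s} (s-odd : s % 2 ≡ 1) (i : Fin m) where

  block-parity : ∀ t {x : Fin m} → toℕ x ≡ (toℕ i + t * s) % m → toℕ x % 2 ≡ (toℕ i + t * s) % 2
  block-parity t x≡ = trans (cong (_% 2) x≡) (m∣n⇒o%n%m≡o%m 2 m (toℕ i + t * s) 2∣m)

  block-ends-parity : ∀ {x y : Fin m} → toℕ x ≡ (toℕ i + 0 * s) % m → toℕ y ≡ (toℕ i + 1 * s) % m →
                      toℕ x % 2 ≢ toℕ y % 2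
  block-ends-parity {x} {y} x≡ y≡ same = [m+odd]%2≢m%2 s-odd (toℕ i) (begin
    (toℕ i + s) % 2      ≡⟨ cong (λ n → (toℕ i + n) % 2) (*-identityˡ s) ⟨
    (toℕ i + 1 * s) % 2  ≡⟨ block-parity 1 y≡ ⟨
    toℕ y % 2            ≡⟨ same ⟨
    toℕ x % 2            ≡⟨ block-parity 0 x≡ ⟩
    (toℕ i + 0) % 2      ≡⟨ cong (_% 2) (+-identityʳ (toℕ i)) ⟩
    toℕ i % 2            ∎)
    where open ≡-Reasoning

  InBlock-parity-injective : ∀ {j x y} → j < 2 → InBlock m s i j x → InBlock m s i j y →
                             toℕ x % 2 ≡ toℕ y % 2 → x ≡ y
  InBlock-parity-injective _ (0 , _ , x≡) (0 , _ , y≡) _    = toℕ-injective (trans x≡ (sym y≡))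
  InBlock-parity-injective _ (1 , _ , x≡) (1 , _ , y≡) _    = toℕ-injective (trans x≡ (sym y≡))
  InBlock-parity-injective _ (0 , _ , x≡) (1 , _ , y≡) same = contradiction same (block-ends-parity x≡ y≡)
  InBlock-parity-injective _ (1 , _ , x≡) (0 , _ , y≡) same = contradiction (sym same) (block-ends-parity y≡ x≡)
  InBlock-parity-injective (s≤s (s≤s ())) (suc (suc _) , s≤s (s≤s _) , _) _ _
  InBlock-parity-injective (s≤s (s≤s ())) _ (suc (suc _) , s≤s (s≤s _) , _) _

S : List ℕ
S = 1 ∷ 3 ∷ []

S-odd : ∀ {s} → s ∈ S → s % 2 ≡ 1
S-odd (here refl)         = refl
S-odd (there (here refl)) = refl

-- pile k b is v_(2k+b).
pile : Fin 4 → Fin 2 → Fin 8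
pile = combine

pile-parity : ∀ k b → toℕ (pile k b) % 2 ≡ toℕ b
pile-parity k b = begin
  toℕ (combine k b) % 2        ≡⟨ cong (_% 2) (toℕ-combine k b) ⟩
  (2 * toℕ k + toℕ b) % 2      ≡⟨ cong (_% 2) (+-comm (2 * toℕ k) (toℕ b)) ⟩
  (toℕ b + 2 * toℕ k) % 2      ≡⟨ [r+2*q]%2≡r (toℕ b) (toℕ k) (toℕ<n b) ⟩
  toℕ b                        ∎
  where open ≡-Reasoning

pile-cases : {P : Fin 8 → Set} → (∀ k b → P (pile k b)) → ∀ l → P l
pile-cases {P} P-pile l = subst P (combine-remQuot {4} 2 l) (P-pile (quotient {4} 2 l) (remainder {4} 2 l))

parityClass : Position 8 → Fin 2 → Vector ℕ 4
parityClass p b k = p (pile k b)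

Balanced : Position 8 → Set
Balanced p = ∀ b → nimSum (parityClass p b) ≡ 0

Balanced? : Decidable Balanced
Balanced? p = all? (λ b → nimSum (parityClass p b) ≟ 0)

Move⇒lone-change-in-class : ∀ {p q} → Move 8 S 2 p q →
  Σ[ b ∈ Fin 2 ] Σ[ k ∈ Fin 4 ]
    q (pile k b) < p (pile k b) × (∀ k′ → k′ ≢ k → q (pile k′ b) ≡ p (pile k′ b))
Move⇒lone-change-in-class {p} {q} (s , s∈S , i , j , j<2 , _ , untouched , l , ql<pl) =
  b , k , subst (λ x → q x < p x) (sym l≡) ql<pl , others
  where
  k = quotient {4} 2 l
  b = remainder {4} 2 l
  l≡ : pile k b ≡ l
  l≡ = combine-remQuot {4} 2 l
  l-parity : toℕ l % 2 ≡ toℕ b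
  l-parity = subst (λ x → toℕ x % 2 ≡ toℕ b) l≡ (pile-parity k b)
  -- l lies in the block (it changed), and the block contains only one pile of l's parity.
  others : ∀ k′ → k′ ≢ k → q (pile k′ b) ≡ p (pile k′ b)
  others k′ k′≢k = untouched (pile k′ b) λ k′∈block → <⇒≢ ql<pl (untouched l λ l∈block →
    k′≢k (combine-injectiveˡ k′ b k b (trans
      (InBlock-parity-injective (divides 4 refl) (S-odd s∈S) i j<2 k′∈block l∈block
        (trans (pile-parity k′ b) (sym l-parity)))
      (sym l≡))))

Move-unbalances : ∀ {p q} → Balanced p → Move 8 S 2 p q → ¬ Balanced q
Move-unbalances {p} {q} Bp mv Bq =
  let b , k , lt , others = Move⇒lone-change-in-class mv
  in <⇒≢ lt (x∙y⁻¹≈ε⇒x≈y (q (pile k b)) (p (pile k b)) (begin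
    q (pile k b) ⊕ p (pile k b)                        ≡⟨ nimSum-change (parityClass p b) (parityClass q b) k others ⟨
    nimSum (parityClass q b) ⊕ nimSum (parityClass p b) ≡⟨ cong₂ _⊕_ (Bq b) (Bp b) ⟩
    0                                                  ∎))
  where open ≡-Reasoning

pattern start = 0 , z≤n , refl
pattern step  = 1 , s≤s z≤n , refl

sharedBlock : ∀ k₀ k₁ → Σ[ s ∈ ℕ ] s ∈ S × Σ[ i ∈ Fin 8 ]
              InBlock 8 s i 1 (pile k₀ 0F) × InBlock 8 s i 1 (pile k₁ 1F)
sharedBlock 0F 0F = 1 , here refl ,         # 0 , start , step
sharedBlock 0F 1F = 3 , there (here refl) , # 0 , start , step
sharedBlock 0F 2F = 3 , there (here refl) , # 5 , step  , start
sharedBlock 0F 3F = 1 , here refl ,         # 7 , step  , start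
sharedBlock 1F 0F = 1 , here refl ,         # 1 , step  , start
sharedBlock 1F 1F = 1 , here refl ,         # 2 , start , step
sharedBlock 1F 2F = 3 , there (here refl) , # 2 , start , step
sharedBlock 1F 3F = 3 , there (here refl) , # 7 , step  , start
sharedBlock 2F 0F = 3 , there (here refl) , # 1 , step  , start
sharedBlock 2F 1F = 1 , here refl ,         # 3 , step  , start
sharedBlock 2F 2F = 1 , here refl ,         # 4 , start , step
sharedBlock 2F 3F = 3 , there (here refl) , # 4 , start , step
sharedBlock 3F 0F = 3 , there (here refl) , # 6 , start , step
sharedBlock 3F 1F = 3 , there (here refl) , # 3 , step  , start
sharedBlock 3F 2F = 1 , here refl ,         # 5 , step  , start
sharedBlock 3F 3F = 1 , here refl ,         # 6 , start , step

¬Balanced⇒balancing-Move : ∀ {p} → ¬ Balanced p → ∃[ q ] Move 8 S 2 p q × Balanced q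
¬Balanced⇒balancing-Move {p} ¬Bp =
  let s , s∈S , i , in₀ , in₁ = sharedBlock (R.index 0F) (R.index 1F)
  in balance , move-within {s} {i} s∈S (λ { 0F → in₀ ; 1F → in₁ }) , balanced
  where
  module R (b : Fin 2) = NimReply (parityClass p b)

  balance : Position 8
  balance l = R.reply (remainder {4} 2 l) (quotient {4} 2 l)

  balance-pile : ∀ k b → balance (pile k b) ≡ R.reply b k
  balance-pile k b = cong (λ (k , b) → R.reply b k) (remQuot-combine k b)

  balanced : Balanced balance
  balanced b = trans (nimSum-cong (λ k → balance-pile k b)) (R.reply-balanced b)

  move-within : ∀ {s i} → s ∈ S → (∀ b → InBlock 8 s i 1 (pile (R.index b) b)) → Move 8 S 2 p balance
  move-within {s} {i} s∈S inBlock = s , s∈S , i , 1 , ≤-refl , decreasing , untouched , strict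
    where
    decreasing : ∀ l → balance l ≤ p l
    decreasing = pile-cases λ k b → subst (_≤ p (pile k b)) (sym (balance-pile k b)) (R.reply-≤ b k)
    untouched : ∀ l → ¬ InBlock 8 s i 1 l → balance l ≡ p l
    untouched = pile-cases λ k b outside → trans (balance-pile k b)
      (R.reply-elsewhere b k λ { refl → outside (inBlock b) })
    strict : Σ[ l ∈ Fin 8 ] balance l < p l
    strict =
      let b , X≢0 = ¬∀⟶∃¬ 2 _ (λ b → nimSum (parityClass p b) ≟ 0) ¬Bp
      in pile (R.index b) b , subst (_< p (pile (R.index b) b)) (sym (balance-pile (R.index b) b)) (R.reply-< b X≢0)

IsP⇔Balanced : ∀ p → IsP 8 S 2 p ⇔ Balanced p
IsP⇔Balanced = IsP⇔kernel Balanced? Move-unbalances ¬Balanced⇒balancing-Move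

mainTheorem9 : (p : Position 8) →
    IsP 8 (1 ∷ 3 ∷ []) 2 p ⇔
      ((p (# 0) ⊕ p (# 2) ⊕ p (# 4) ⊕ p (# 6) ≡ 0) ×
       (p (# 1) ⊕ p (# 3) ⊕ p (# 5) ⊕ p (# 7) ≡ 0))
mainTheorem9 p =
  mk⇔ (λ Bp → trans (sym (nimSum₄ (parityClass p 0F))) (Bp 0F) ,
              trans (sym (nimSum₄ (parityClass p 1F))) (Bp 1F))
      (λ { (X₀≡0 , _) 0F → trans (nimSum₄ (parityClass p 0F)) X₀≡0
         ; (_ , X₁≡0) 1F → trans (nimSum₄ (parityClass p 1F)) X₁≡0 })
  ⇔-∘ IsP⇔Balanced p
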